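{- For all integers $r, d \geq 1$, the complete bipartite graph $K_{r,d}$ satisfies $\chi'_{st}(K_{r,d}) \leq 15\left\lceil \frac{d}{8} \right\rceil \left\lceil \frac{r}{8} \right\rceil$.
   Context: A star edge coloring of a graph is a proper edge coloring in which there is no path or cycle of length four (i.e., with four edges) whose edges use only two colors. The star chromatic index $\chi'_{st}(G)$ is the minimum number $t$ such that $G$ has a star edge coloring with $t$ colors. -}

module Defs where

open import Data.Nat using (ℕ; _+_; _*_; _/_)
open import Data.Fin using (Fin)
open import Data.Sum using (_⊎_; inj₁; inj₂)
open import Data.Product using (_×_; Σ; ∃; ∃-syntax; _,_)
open import Data.Unit using (⊤; tt)
open import Data.Empty using (⊥)
open import Relation.Nullary using (¬_)
open import Relation.Binary.PropositionalEquality using (_≡_; _≢_)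

⌈_/8⌉ : ℕ → ℕ
⌈ n /8⌉ = (n + 7) / 8

Vertex : ℕ → ℕ → Set
Vertex r d = Fin r ⊎ Fin d

Adj : ∀ {r d} → Vertex r d → Vertex r d → Set
Adj (inj₁ _) (inj₁ _) = ⊥
Adj (inj₁ _) (inj₂ _) = ⊤
Adj (inj₂ _) (inj₁ _) = ⊤
Adj (inj₂ _) (inj₂ _) = ⊥

EdgeColouring : ℕ → ℕ → ℕ → Set
EdgeColouring r d t = Fin r → Fin d → Fin t

colOf : ∀ {r d t} → EdgeColouring r d t →
        (u v : Vertex r d) → Adj u v → Fin t
colOf c (inj₁ i) (inj₂ j) _ = c i j
colOf c (inj₂ j) (inj₁ i) _ = c i j

Proper : ∀ {r d t} → EdgeColouring r d t → Set
Proper {r} {d} c =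
  (∀ (i : Fin r) (j j' : Fin d) → j ≢ j' → c i j ≢ c i j') ×
  (∀ (i i' : Fin r) (j : Fin d) → i ≢ i' → c i j ≢ c i' j)

-- A path or cycle with four edges: vertices v0 v1 v2 v3 v4, consecutive
-- ones adjacent, all pairwise distinct except that v4 = v0 is allowed
-- (which gives a 4-cycle).
record Walk4 (r d : ℕ) : Set where
  field
    v0 v1 v2 v3 v4 : Vertex r d
    a1 : Adj v0 v1
    a2 : Adj v1 v2
    a3 : Adj v2 v3
    a4 : Adj v3 v4
    d01 : v0 ≢ v1
    d02 : v0 ≢ v2
    d03 : v0 ≢ v3
    d12 : v1 ≢ v2
    d13 : v1 ≢ v3
    d14 : v1 ≢ v4
    d23 : v2 ≢ v3
    d24 : v2 ≢ v4
    d34 : v3 ≢ v4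

Bicoloured : ∀ {r d t} → EdgeColouring r d t → Walk4 r d → Set
Bicoloured {t = t} c w =
  ∃[ a ] ∃[ b ] (In (colOf c v0 v1 a1) a b × In (colOf c v1 v2 a2) a b ×
                 In (colOf c v2 v3 a3) a b × In (colOf c v3 v4 a4) a b)
  where
    open Walk4 w
    In : Fin t → Fin t → Fin t → Set
    In x a b = (x ≡ a) ⊎ (x ≡ b)

StarEdgeColouring : ∀ {r d t} → EdgeColouring r d t → Set
StarEdgeColouring {r} {d} c = Proper c × (∀ (w : Walk4 r d) → ¬ Bicoloured c w)

StarChromaticIndex≤ : ℕ → ℕ → ℕ → Set
StarChromaticIndex≤ r d N = Σ (EdgeColouring r d N) StarEdgeColouring

-- A star edge colouring of K₈,₈ with 15 colours, checked by exhaustive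
-- computation, is blown up: both sides of K_{r,d} are cut into ⌈·/8⌉ blocks of
-- at most 8 vertices, and the edge ij gets the colour of the base edge between
-- the positions of i and j in their blocks, tagged with the pair of blocks.
-- Edges of equal colour then join the same two blocks, so a path whose first
-- and third, and second and fourth, edges share a colour stays inside a pair of
-- blocks and projects onto such a path in K₈,₈.  In a proper colouring of a
-- bipartite graph these alternating paths are exactly the bicoloured paths and
-- 4-cycles.
module Submission where

open import Defs
open import Data.Nat using (ℕ; _*_; _≥_; _+_; _≤_; _%_)
open import Data.Nat.Properties
  using (+-cancelˡ-≤; +-monoˡ-≤; +-comm; ≤-pred; module ≤-Reasoning)
open import Data.Nat.DivMod using (m≡m%n+[m/n]*n; m%n<n)
open import Data.Fin using (Fin; #_; inject≤; combine; quotient; remainder)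
open import Data.Fin.Properties
  using (_≟_; all?; inject≤-injective; combine-injective; combine-remQuot)
open import Data.Vec using (Vec; []; _∷_; lookup)
open import Data.Sum using (_⊎_; inj₁; inj₂)
open import Data.Product using (_×_; _,_; ∃-syntax)
open import Data.Empty using (⊥-elim)
open import Function using (_∘_; flip)
open import Function.Definitions using (Injective)
open import Relation.Nullary using (¬_; Dec; ¬?)
open import Relation.Nullary.Decidable using (_→-dec_; _×-dec_; map′; from-yes)
open import Relation.Binary.PropositionalEquality
  using (_≡_; _≢_; sym; trans; cong; cong₂; module ≡-Reasoning)

private
  variable
    A : Set
    r d t p q t′ : ℕ
    c : EdgeColouring p q t
    c′ : EdgeColouring r d t′
    σ : Fin r → Fin p
    τ : Fin d → Fin q

-- Paths i₀ j₀ i₁ j₁ i₂ starting in the left part; those starting in the right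
-- part are the paths of flip c.
NoAlternatingPath : EdgeColouring r d t → Set
NoAlternatingPath c = ∀ i₀ i₁ i₂ j₀ j₁ → i₀ ≢ i₁ → i₁ ≢ i₂ → j₀ ≢ j₁ →
  c i₀ j₀ ≡ c i₁ j₁ → c i₁ j₀ ≢ c i₂ j₁

record IsStar (c : EdgeColouring r d t) : Set where
  field
    proper : Proper c
    noAlternatingPathˡ : NoAlternatingPath c
    noAlternatingPathʳ : NoAlternatingPath (flip c)

proper-flip : {c : EdgeColouring r d t} → Proper c → Proper (flip c)
proper-flip (rows , columns) = (λ j i i′ → columns i i′ j) , (λ j j′ i → rows i j j′)

alternates-in-two-values : {a b x y z : A} →
  x ≡ a ⊎ x ≡ b → y ≡ a ⊎ y ≡ b → z ≡ a ⊎ z ≡ b → x ≢ y → y ≢ z → x ≡ z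
alternates-in-two-values (inj₁ x≡a) (inj₂ _) (inj₁ z≡a) _ _ = trans x≡a (sym z≡a)
alternates-in-two-values (inj₂ x≡b) (inj₁ _) (inj₂ z≡b) _ _ = trans x≡b (sym z≡b)
alternates-in-two-values (inj₁ x≡a) (inj₁ y≡a) _ x≢y _ = ⊥-elim (x≢y (trans x≡a (sym y≡a)))
alternates-in-two-values (inj₂ x≡b) (inj₂ y≡b) _ x≢y _ = ⊥-elim (x≢y (trans x≡b (sym y≡b)))
alternates-in-two-values _ (inj₁ y≡a) (inj₁ z≡a) _ y≢z = ⊥-elim (y≢z (trans y≡a (sym z≡a)))
alternates-in-two-values _ (inj₂ y≡b) (inj₂ z≡b) _ y≢z = ⊥-elim (y≢z (trans y≡b (sym z≡b)))

TwoColoured : (w x y z : Fin t) → Set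
TwoColoured {t} w x y z = ∃[ a ] ∃[ b ] (In w a b × In x a b × In y a b × In z a b)
  where
  In : Fin t → Fin t → Fin t → Set
  In u a b = u ≡ a ⊎ u ≡ b

proper-noAlternatingPath⇒¬twoColoured :
  {c : EdgeColouring r d t} → Proper c → NoAlternatingPath c →
  ∀ {i₀ i₁ i₂ j₀ j₁} → i₀ ≢ i₁ → i₁ ≢ i₂ → j₀ ≢ j₁ →
  ¬ TwoColoured (c i₀ j₀) (c i₁ j₀) (c i₁ j₁) (c i₂ j₁)
proper-noAlternatingPath⇒¬twoColoured {c = c} (rows , columns) noAlt
  {i₀} {i₁} {i₂} {j₀} {j₁} i₀≢i₁ i₁≢i₂ j₀≢j₁ (_ , _ , e₁ , e₂ , e₃ , e₄) =
  noAlt i₀ i₁ i₂ j₀ j₁ i₀≢i₁ i₁≢i₂ j₀≢j₁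
    (alternates-in-two-values e₁ e₂ e₃ (columns i₀ i₁ j₀ i₀≢i₁) (rows i₁ j₀ j₁ j₀≢j₁))
    (alternates-in-two-values e₂ e₃ e₄ (rows i₁ j₀ j₁ j₀≢j₁) (columns i₁ i₂ j₁ i₁≢i₂))

isStar⇒starEdgeColouring : {c : EdgeColouring r d t} → IsStar c → StarEdgeColouring c
isStar⇒starEdgeColouring {c = c} star = proper , noBicolouredWalk
  where
  open IsStar star
  noBicolouredWalk : ∀ w → ¬ Bicoloured c w
  noBicolouredWalk record { v0 = inj₁ _ ; v1 = inj₁ _ ; a1 = () }
  noBicolouredWalk record { v0 = inj₂ _ ; v1 = inj₂ _ ; a1 = () }
  noBicolouredWalk record { v1 = inj₁ _ ; v2 = inj₁ _ ; a2 = () }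
  noBicolouredWalk record { v1 = inj₂ _ ; v2 = inj₂ _ ; a2 = () }
  noBicolouredWalk record { v2 = inj₁ _ ; v3 = inj₁ _ ; a3 = () }
  noBicolouredWalk record { v2 = inj₂ _ ; v3 = inj₂ _ ; a3 = () }
  noBicolouredWalk record { v3 = inj₁ _ ; v4 = inj₁ _ ; a4 = () }
  noBicolouredWalk record { v3 = inj₂ _ ; v4 = inj₂ _ ; a4 = () }
  noBicolouredWalk record
    { v0 = inj₁ _ ; v1 = inj₂ _ ; v2 = inj₁ _ ; v3 = inj₂ _ ; v4 = inj₁ _
    ; d02 = d02 ; d13 = d13 ; d24 = d24 } =
    proper-noAlternatingPath⇒¬twoColoured proper noAlternatingPathˡ
      (d02 ∘ cong inj₁) (d24 ∘ cong inj₁) (d13 ∘ cong inj₂)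
  noBicolouredWalk record
    { v0 = inj₂ _ ; v1 = inj₁ _ ; v2 = inj₂ _ ; v3 = inj₁ _ ; v4 = inj₂ _
    ; d02 = d02 ; d13 = d13 ; d24 = d24 } =
    proper-noAlternatingPath⇒¬twoColoured (proper-flip proper) noAlternatingPathʳ
      (d02 ∘ cong inj₂) (d24 ∘ cong inj₂) (d13 ∘ cong inj₁)

IsLiftOf : EdgeColouring r d t′ → (Fin r → Fin p) → (Fin d → Fin q) →
           EdgeColouring p q t → Set
IsLiftOf c′ σ τ c = ∀ {i i′ j j′} → c′ i j ≡ c′ i′ j′ →
  (i ≢ i′ → σ i ≢ σ i′) × (j ≢ j′ → τ j ≢ τ j′) × c (σ i) (τ j) ≡ c (σ i′) (τ j′)

isLiftOf-flip : IsLiftOf c′ σ τ c → IsLiftOf (flip c′) τ σ (flip c)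
isLiftOf-flip lift e with σ≢ , τ≢ , e′ ← lift e = τ≢ , σ≢ , e′

isLiftOf-proper : IsLiftOf c′ σ τ c → Proper c → Proper c′
isLiftOf-proper {σ = σ} {τ = τ} lift (rows , columns) =
  (λ i j j′ j≢j′ e → let _ , τ≢ , e′ = lift e in rows (σ i) (τ j) (τ j′) (τ≢ j≢j′) e′) ,
  (λ i i′ j i≢i′ e → let σ≢ , _ , e′ = lift e in columns (σ i) (σ i′) (τ j) (σ≢ i≢i′) e′)

isLiftOf-noAlternatingPath : IsLiftOf c′ σ τ c → NoAlternatingPath c → NoAlternatingPath c′
isLiftOf-noAlternatingPath {σ = σ} {τ = τ} lift noAlt i₀ i₁ i₂ j₀ j₁ i₀≢i₁ i₁≢i₂ j₀≢j₁ e₁ e₂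
  with σ≢₀₁ , τ≢₀₁ , e₁′ ← lift e₁ | σ≢₁₂ , _ , e₂′ ← lift e₂ =
  noAlt (σ i₀) (σ i₁) (σ i₂) (τ j₀) (τ j₁) (σ≢₀₁ i₀≢i₁) (σ≢₁₂ i₁≢i₂) (τ≢₀₁ j₀≢j₁) e₁′ e₂′

isLiftOf-isStar : IsLiftOf c′ σ τ c → IsStar c → IsStar c′
isLiftOf-isStar {c = c} lift star = record
  { proper = isLiftOf-proper lift proper
  ; noAlternatingPathˡ = isLiftOf-noAlternatingPath lift noAlternatingPathˡ
  ; noAlternatingPathʳ = isLiftOf-noAlternatingPath (isLiftOf-flip {c = c} lift) noAlternatingPathʳ
  }
  where open IsStar star

reindex-isLiftOf : (c : EdgeColouring p q t) {σ : Fin r → Fin p} {τ : Fin d → Fin q} →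
  Injective _≡_ _≡_ σ → Injective _≡_ _≡_ τ → IsLiftOf (λ i j → c (σ i) (τ j)) σ τ c
reindex-isLiftOf c σ-injective τ-injective e = _∘ σ-injective , _∘ τ-injective , e

isStar-restrict : {c : EdgeColouring p q t} (r≤p : r ≤ p) (d≤q : d ≤ q) → IsStar c →
  IsStar (λ i j → c (inject≤ i r≤p) (inject≤ j d≤q))
isStar-restrict {c = c} r≤p d≤q =
  isLiftOf-isStar (reindex-isLiftOf c (inject≤-injective r≤p r≤p _ _)
                                      (inject≤-injective d≤q d≤q _ _))

blowUp : (a b : ℕ) → EdgeColouring p q t → EdgeColouring (a * p) (b * q) (t * b * a)
blowUp {p} {q} a b c i j =
  combine (combine (c (remainder {a} p i) (remainder {b} q j)) (quotient {b} q j))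
          (quotient {a} p i)

remainder-≢ : ∀ {a} p {i i′ : Fin (a * p)} →
  quotient {a} p i ≡ quotient {a} p i′ → i ≢ i′ → remainder {a} p i ≢ remainder {a} p i′
remainder-≢ {a} p {i} {i′} same-block i≢i′ same-position = i≢i′ (begin
  i                                                ≡⟨ combine-remQuot {a} p i ⟨
  combine (quotient {a} p i) (remainder {a} p i)   ≡⟨ cong₂ combine same-block same-position ⟩
  combine (quotient {a} p i′) (remainder {a} p i′) ≡⟨ combine-remQuot {a} p i′ ⟩
  i′                                               ∎)
  where open ≡-Reasoning

blowUp-isLiftOf : ∀ a b (c : EdgeColouring p q t) →
  IsLiftOf (blowUp a b c) (remainder {a} p) (remainder {b} q) c
blowUp-isLiftOf {p} {q} a b c e
  with same-colour-and-column , same-row ← combine-injective _ _ _ _ e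
  with same-colour , same-column ← combine-injective _ _ _ _ same-colour-and-column =
  remainder-≢ p same-row , remainder-≢ q same-column , same-colour

proper? : (c : EdgeColouring r d t) → Dec (Proper c)
proper? c =
  (all? λ i → all? λ j → all? λ j′ → ¬? (j ≟ j′) →-dec ¬? (c i j ≟ c i j′)) ×-dec
  (all? λ i → all? λ i′ → all? λ j → ¬? (i ≟ i′) →-dec ¬? (c i j ≟ c i′ j))

noAlternatingPath? : (c : EdgeColouring r d t) → Dec (NoAlternatingPath c)
noAlternatingPath? c =
  all? λ i₀ → all? λ i₁ → all? λ i₂ → all? λ j₀ → all? λ j₁ →
  ¬? (i₀ ≟ i₁) →-dec ¬? (i₁ ≟ i₂) →-dec ¬? (j₀ ≟ j₁) →-dec
  (c i₀ j₀ ≟ c i₁ j₁) →-dec ¬? (c i₁ j₀ ≟ c i₂ j₁)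

isStar? : (c : EdgeColouring r d t) → Dec (IsStar c)
isStar? c = map′
  (λ (pr , noAltˡ , noAltʳ) → record
    { proper = pr ; noAlternatingPathˡ = noAltˡ ; noAlternatingPathʳ = noAltʳ })
  (λ star → let open IsStar star in proper , noAlternatingPathˡ , noAlternatingPathʳ)
  (proper? c ×-dec noAlternatingPath? c ×-dec noAlternatingPath? (flip c))

K₈,₈-colouring : EdgeColouring 8 8 15
K₈,₈-colouring i j = lookup (lookup table i) j
  where
  table : Vec (Vec (Fin 15) 8) 8
  table =
    (# 14 ∷ # 0  ∷ # 2  ∷ # 5  ∷ # 6  ∷ # 9  ∷ # 11 ∷ # 12 ∷ []) ∷
    (# 1  ∷ # 14 ∷ # 4  ∷ # 2  ∷ # 9  ∷ # 7  ∷ # 13 ∷ # 11 ∷ []) ∷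
    (# 3  ∷ # 5  ∷ # 14 ∷ # 1  ∷ # 11 ∷ # 12 ∷ # 7  ∷ # 8  ∷ []) ∷
    (# 4  ∷ # 3  ∷ # 0  ∷ # 14 ∷ # 13 ∷ # 11 ∷ # 8  ∷ # 6  ∷ []) ∷
    (# 7  ∷ # 8  ∷ # 10 ∷ # 12 ∷ # 14 ∷ # 0  ∷ # 2  ∷ # 4  ∷ []) ∷
    (# 8  ∷ # 6  ∷ # 13 ∷ # 10 ∷ # 1  ∷ # 14 ∷ # 5  ∷ # 2  ∷ []) ∷
    (# 10 ∷ # 12 ∷ # 6  ∷ # 9  ∷ # 3  ∷ # 4  ∷ # 14 ∷ # 1  ∷ []) ∷
    (# 13 ∷ # 10 ∷ # 9  ∷ # 7  ∷ # 5  ∷ # 3  ∷ # 0  ∷ # 14 ∷ []) ∷ []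

K₈,₈-colouring-isStar : IsStar K₈,₈-colouring
K₈,₈-colouring-isStar = from-yes (isStar? K₈,₈-colouring)

n≤⌈n/8⌉*8 : ∀ n → n ≤ ⌈ n /8⌉ * 8
n≤⌈n/8⌉*8 n = +-cancelˡ-≤ 7 n (⌈ n /8⌉ * 8) (begin
  7 + n                          ≡⟨ +-comm 7 n ⟩
  n + 7                          ≡⟨ m≡m%n+[m/n]*n (n + 7) 8 ⟩
  (n + 7) % 8 + ⌈ n /8⌉ * 8      ≤⟨ +-monoˡ-≤ (⌈ n /8⌉ * 8) (≤-pred (m%n<n (n + 7) 8)) ⟩
  7 + ⌈ n /8⌉ * 8                ∎)
  where open ≤-Reasoning

corollary6 : ∀ (r d : ℕ) → r ≥ 1 → d ≥ 1 →
    StarChromaticIndex≤ r d (15 * ⌈ d /8⌉ * ⌈ r /8⌉)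
corollary6 r d _ _ = colouring , isStar⇒starEdgeColouring (isStar-restrict r≤ d≤ blownUp-isStar)
  where
  r≤ : r ≤ ⌈ r /8⌉ * 8
  r≤ = n≤⌈n/8⌉*8 r
  d≤ : d ≤ ⌈ d /8⌉ * 8
  d≤ = n≤⌈n/8⌉*8 d
  blownUp : EdgeColouring (⌈ r /8⌉ * 8) (⌈ d /8⌉ * 8) (15 * ⌈ d /8⌉ * ⌈ r /8⌉)
  blownUp = blowUp ⌈ r /8⌉ ⌈ d /8⌉ K₈,₈-colouring
  blownUp-isStar : IsStar blownUp
  blownUp-isStar =
    isLiftOf-isStar (blowUp-isLiftOf ⌈ r /8⌉ ⌈ d /8⌉ K₈,₈-colouring) K₈,₈-colouring-isStar
  colouring : EdgeColouring r d (15 * ⌈ d /8⌉ * ⌈ r /8⌉)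
  colouring i j = blownUp (inject≤ i r≤) (inject≤ j d≤)
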